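{- For $d>0$ and $r\ge0$, the tableau $P(w^{(d,r)})$ has shifted shape $Z(d,r)$, and its entries are $P(w^{(d,r)})(i,j)=r-j$ if $j<0$ and $P(w^{(d,r)})(i,j)=j$ if $j\ge0$, for all boxes $(i,j)$ of $D(Z(d,r))$.
   Context: Signed permutations: $W(B_n)$ is the group of permutations $w$ of $\{\pm1,\dots,\pm n\}$ with $w(-i)=-w(i)$, written $w(1)\cdots w(n)$. Generators $s_0,\dots,s_{n-1}$: $ws_0$ negates the first entry of $w$ in one-line notation, and $ws_k$ ($k\ge1$) swaps the entries in positions $k,k+1$. A reduced word of $w$ is a word $a_1\cdots a_m$ in $\{0,\dots,n-1\}$ of minimal length $m$ with $w=s_{a_1}\cdots s_{a_m}$; $\mathrm{Red}(w)$ is their set. Shifted shapes: for a strict partition $\lambda=(\lambda_1>\cdots>\lambda_m>0)$, $D(\lambda)=\{(i,j-m+i-1):1\le i\le m,1\le j\le\lambda_i\}$ (row $i$ occupies columns $i-m,\dots,\lambda_i-m+i-1$). The trapezoid $Z(d,r)=(r+2d-1,r+2d-3,\dots,r+1)$ ($d$ parts); row $i$ of $D(Z(d,r))$ occupies columns $i-d,\dots,r+d-i$. $w^{(d,r)}\in W(B_{d+r})$: $w^{(d,r)}(i)=d+i$ for $1\le i\le r$, $w^{(d,r)}(i)=-(i-r)$ for $r<i\le d+r$. A word $r_1\cdots r_m$ is unimodal if $r_1>r_2>\cdots>r_k<r_{k+1}<\cdots<r_m$ for some $1\le k\le m$. For a shifted tableau $T$ with $m$ rows, let $T_i$ be the word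 formed by row $i$ read left to right, and $\pi(T)=T_mT_{m-1}\cdots T_1$ (concatenation). $T$ is a standard decomposition tableau of $w$, $T\in\mathrm{SDT}(w)$, if $\pi(T)\in\mathrm{Red}(w)$ and for each $i$, $T_i$ is unimodal and its length equals the maximal length of a unimodal (not necessarily consecutive) subsequence of $T_mT_{m-1}\cdots T_i$. It is known that $w^{(d,r)}$ is vexillary, i.e. $\mathrm{SDT}(w^{(d,r)})$ consists of exactly one tableau, denoted $P(w^{(d,r)})$. -}

module Defs where

open import Data.Nat as ℕ using (ℕ; zero; suc; _+_; _*_; _≤_; _<_; _>_)
open import Data.Integer as ℤ using (ℤ; +_; -[1+_])
open import Data.List using (List; []; _∷_; _++_; length; map; concat; reverse; applyUpTo)
open import Data.List.Relation.Unary.All using (All)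
open import Data.List.Relation.Unary.Linked using (Linked)
open import Data.List.Relation.Binary.Sublist.Propositional using (_⊆_)
open import Data.Maybe using (Maybe; just; nothing)
open import Data.Product using (Σ; ∃; _×_; _,_)
open import Relation.Binary.PropositionalEquality using (_≡_)

-- Signed permutations in one-line notation w(1) ⋯ w(n), as lists of ℤ.

neg-first : List ℤ → List ℤ
neg-first []       = []
neg-first (x ∷ xs) = ℤ.- x ∷ xs

-- w s_k (k ≥ 1) : swap the entries in positions k, k+1 (1-indexed)
swapAt : ℕ → List ℤ → List ℤ
swapAt (suc zero)    (x ∷ y ∷ xs) = y ∷ x ∷ xs
swapAt (suc (suc k)) (x ∷ xs)     = x ∷ swapAt (suc k) xs
swapAt _             xs           = xs

rmul : List ℤ → ℕ → List ℤ
rmul w zero    = neg-first w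
rmul w (suc k) = swapAt (suc k) w

act : List ℤ → List ℕ → List ℤ
act w []       = w
act w (a ∷ as) = act (rmul w a) as

idB : ℕ → List ℤ
idB n = applyUpTo (λ i → + suc i) n

IsWord : ℕ → List ℤ → List ℕ → Set
IsWord n w a = All (_< n) a × act (idB n) a ≡ w

IsReduced : ℕ → List ℤ → List ℕ → Set
IsReduced n w a = IsWord n w a × (∀ b → IsWord n w b → length a ≤ length b)

wdr : ℕ → ℕ → List ℤ
wdr d r = applyUpTo (λ i → + (d + suc i)) r ++ applyUpTo (λ i → ℤ.- (+ suc i)) d

Unimodal : List ℕ → Set
Unimodal u = Σ (List ℕ) λ xs → Σ ℕ λ a → Σ (List ℕ) λ ys →
  (u ≡ xs ++ a ∷ ys) × Linked _>_ (xs ++ a ∷ []) × Linked _<_ (a ∷ ys)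

IsMaxUnimodalLength : ℕ → List ℕ → Set
IsMaxUnimodalLength ℓ v =
  (Σ (List ℕ) λ u → u ⊆ v × Unimodal u × length u ≡ ℓ) ×
  (∀ u → u ⊆ v → Unimodal u → length u ≤ ℓ)

-- Shifted tableaux: list of rows T₁, T₂, …, T_m (row 1 first), each row
-- read left to right; the shape is the list of row lengths, which must
-- be a strict partition.

Tableau : Set
Tableau = List (List ℕ)

shape : Tableau → List ℕ
shape T = map length T

IsStrictPartition : List ℕ → Set
IsStrictPartition λ′ = Linked _>_ λ′ × All (0 <_) λ′

readingWord : Tableau → List ℕ
readingWord T = concat (reverse T)

RowConditions : Tableau → Set
RowConditions []          = ⊤′
  where open import Data.Unit using () renaming (⊤ to ⊤′)
RowConditions (row ∷ rest) =
  Unimodal row × IsMaxUnimodalLength (length row) (concat (reverse (row ∷ rest)))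
  × RowConditions rest

IsSDT : ℕ → List ℤ → Tableau → Set
IsSDT n w T = IsStrictPartition (shape T) × IsReduced n w (readingWord T) × RowConditions T

nth : {A : Set} → List A → ℕ → Maybe A
nth []       _       = nothing
nth (x ∷ xs) zero    = just x
nth (x ∷ xs) (suc k) = nth xs k

InD : List ℕ → ℕ → ℤ → Set
InD λ′ zero    j = ⊥′
  where open import Data.Empty using () renaming (⊥ to ⊥′)
InD λ′ (suc i) j = Σ ℕ λ λi → (nth λ′ i ≡ just λi) ×
  ((+ suc i ℤ.- + length λ′) ℤ.≤ j) × (j ℤ.≤ (+ λi ℤ.- + length λ′ ℤ.+ + suc i ℤ.- + 1))

-- entry T(i , j): row i occupies columns i - m, …, so box (i , j) is
-- position j - (i - m) (0-indexed) of row i.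
entry : Tableau → ℕ → ℤ → Maybe ℕ
entry T zero    j = nothing
entry T (suc i) j with j ℤ.- (+ suc i ℤ.- + length T) | nth T i
... | + p      | just row = nth row p
... | + p      | nothing  = nothing
... | -[1+ _ ] | _        = nothing

Z : ℕ → ℕ → List ℕ
Z zero    r = []
Z (suc d) r = (r + 2 * d + 1) ∷ Z d r

Pval : ℕ → ℤ → ℕ
Pval r (+ n)     = n
Pval r -[1+ n ]  = r + suc n

-- The rows of P(w^{(d,r)}), read from the bottom row (k = 0) to the top row (k = d - 1), are
-- r+k ⋯ r+1 0 1 ⋯ r+k.  Acting on the right, row k takes (k+1) ⋯ (k+r) (-1) ⋯ (-k) (k+r+1) ⋯ to
-- (k+2) ⋯ (k+r+1) (-1) ⋯ (-k-1) ⋯: its descending part brings k+r+1 in front of the negative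
-- block, s₀ negates the leading k+1, and its ascending part carries -(k+1) to the end of that
-- block.  So the reading word is a word for w^{(d,r)} of length rd + d², which is the type-B
-- length of w^{(d,r)}; as no generator changes that length by more than one, the word is reduced.
-- A unimodal subsequence of the bottom k+1 rows has at most r+k letters after its minimum (they
-- increase and are ≤ r+k) and at most k+1 letters up to it: label the letters so that labels are
-- ≤ k and every descent strictly increases the label.  This totals r+2k+1, the length of row k.

module Submission where

open import Defs
open import Data.Nat using (ℕ; zero; suc; _+_; _*_; _∸_; _⊓_; _≤_; _<_; _>_; z≤n; s≤s)
open import Data.Nat.Properties
open import Data.Nat.Tactic.RingSolver using (solve-∀)
open import Data.Integer as ℤ using (ℤ; +_; -[1+_])
import Data.Integer.Properties as ℤP
import Data.Integer.Tactic.RingSolver as ℤSolver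
open import Data.List using (List; []; _∷_; _++_; length; map; concat; reverse; applyUpTo)
open import Data.List.Properties
open import Data.List.Relation.Unary.All as All using (All; []; _∷_)
import Data.List.Relation.Unary.All.Properties as AllP
open import Data.List.Relation.Unary.AllPairs as AllPairs using (AllPairs; []; _∷_)
import Data.List.Relation.Unary.AllPairs.Properties as AllPairs
open import Data.List.Relation.Unary.Linked using (Linked; []; [-]; _∷_)
open import Data.List.Relation.Unary.Linked.Properties using (Linked⇒AllPairs)
open import Data.List.Relation.Binary.Sublist.Propositional
  using (_⊆_; []; _∷_; _∷ʳ_; ⊆-refl; ⊆-trans; minimum)
open import Data.List.Relation.Binary.Sublist.Propositional.Properties using (All-resp-⊆; ++⁺; ++⁺ˡ)
open import Data.Maybe using (just)
open import Data.Product using (Σ; _×_; _,_; proj₁; proj₂)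
open import Data.Unit using (tt)
open import Function using (_∘_)
open import Relation.Binary.PropositionalEquality
open import Relation.Nullary using (¬_; yes; no; contradiction)

-- Words acting on signed permutations

act-++ : ∀ w as bs → act w (as ++ bs) ≡ act (act w as) bs
act-++ w []       bs = refl
act-++ w (a ∷ as) bs = act-++ (rmul w a) as bs

swapAt-middle : ∀ (ps : List ℤ) x y zs →
  swapAt (suc (length ps)) (ps ++ x ∷ y ∷ zs) ≡ ps ++ y ∷ x ∷ zs
swapAt-middle []           x y zs = refl
swapAt-middle (p ∷ [])     x y zs = refl
swapAt-middle (p ∷ q ∷ ps) x y zs = cong (p ∷_) (swapAt-middle (q ∷ ps) x y zs)

length-∷ʳ : ∀ (ps : List ℤ) x → length (ps ++ x ∷ []) ≡ suc (length ps)
length-∷ʳ ps x = trans (length-++ ps) (+-comm (length ps) 1)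

descending : ℕ → ℕ → List ℕ
descending a zero    = []
descending a (suc n) = a + suc n ∷ descending a n

ascending : ℕ → ℕ → List ℕ
ascending a zero    = []
ascending a (suc n) = a ∷ ascending (suc a) n

length-descending : ∀ a n → length (descending a n) ≡ n
length-descending a zero    = refl
length-descending a (suc n) = cong suc (length-descending a n)

length-ascending : ∀ a n → length (ascending a n) ≡ n
length-ascending a zero    = refl
length-ascending a (suc n) = cong suc (length-ascending (suc a) n)

descending-bounds : ∀ r n → All (λ v → r < v × v ≤ r + n) (descending r n)
descending-bounds r zero    = []
descending-bounds r (suc n) = (m<m+n r (s≤s z≤n) , ≤-refl)
  ∷ All.map (λ (r<v , v≤) → r<v , ≤-trans v≤ (+-monoʳ-≤ r (n≤1+n n))) (descending-bounds r n)

ascending-< : ∀ a n → All (_< a + n) (ascending a n)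
ascending-< a zero    = []
ascending-< a (suc n) = m<m+n a (s≤s z≤n)
  ∷ subst (λ b → All (_< b) (ascending (suc a) n)) (sym (+-suc a n)) (ascending-< (suc a) n)

descending-decreasing : ∀ r n → Linked _>_ (descending r n ++ 0 ∷ [])
descending-decreasing r zero          = [-]
descending-decreasing r (suc zero)    = m≤n+m 1 r ∷ [-]
descending-decreasing r (suc (suc n)) = +-monoʳ-< r (n<1+n (suc n)) ∷ descending-decreasing r (suc n)

ascending-increasing : ∀ a n → Linked _<_ (ascending a n)
ascending-increasing a zero          = []
ascending-increasing a (suc zero)    = [-]
ascending-increasing a (suc (suc n)) = n<1+n a ∷ ascending-increasing (suc a) (suc n)

descending-unfoldʳ : ∀ a n → descending a (suc n) ≡ descending (suc a) n ++ suc a ∷ []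
descending-unfoldʳ a zero    = cong (_∷ []) (+-comm a 1)
descending-unfoldʳ a (suc n) =
  cong₂ _∷_ (+-suc a (suc n)) (descending-unfoldʳ a n)

act-descending : ∀ ps xs y zs {a n} → length ps ≡ a → length xs ≡ n →
  act (ps ++ xs ++ y ∷ zs) (descending a n) ≡ ps ++ y ∷ xs ++ zs
act-descending ps []       y zs refl refl = refl
act-descending ps (x ∷ xs) y zs {n = suc n} refl refl = begin
    act (ps ++ x ∷ xs ++ y ∷ zs) (descending (length ps) (suc n))
  ≡⟨ cong (act _) (descending-unfoldʳ (length ps) n) ⟩
    act (ps ++ x ∷ xs ++ y ∷ zs) (moves ++ last)
  ≡⟨ act-++ _ moves last ⟩
    act (act (ps ++ x ∷ xs ++ y ∷ zs) moves) last
  ≡⟨ cong (λ w → act (act w moves) last) (sym (++-assoc ps (x ∷ []) _)) ⟩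
    act (act ((ps ++ x ∷ []) ++ xs ++ y ∷ zs) moves) last
  ≡⟨ cong (λ w → act w last) (act-descending (ps ++ x ∷ []) xs y zs (length-∷ʳ ps x) refl) ⟩
    swapAt (suc (length ps)) ((ps ++ x ∷ []) ++ y ∷ xs ++ zs)
  ≡⟨ cong (swapAt _) (++-assoc ps (x ∷ []) _) ⟩
    swapAt (suc (length ps)) (ps ++ x ∷ y ∷ xs ++ zs)
  ≡⟨ swapAt-middle ps x y _ ⟩
    ps ++ y ∷ x ∷ xs ++ zs
  ∎
  where
  open ≡-Reasoning
  moves = descending (suc (length ps)) n
  last  = suc (length ps) ∷ []

act-ascending : ∀ ps x xs zs {a n} → suc (length ps) ≡ a → length xs ≡ n →
  act (ps ++ x ∷ xs ++ zs) (ascending a n) ≡ ps ++ xs ++ x ∷ zs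
act-ascending ps x []       zs refl refl = refl
act-ascending ps x (y ∷ xs) zs refl refl = begin
    act (swapAt (suc (length ps)) (ps ++ x ∷ y ∷ xs ++ zs)) moves
  ≡⟨ cong (λ w → act w moves) (swapAt-middle ps x y _) ⟩
    act (ps ++ y ∷ x ∷ xs ++ zs) moves
  ≡⟨ cong (λ w → act w moves) (sym (++-assoc ps (y ∷ []) _)) ⟩
    act ((ps ++ y ∷ []) ++ x ∷ xs ++ zs) moves
  ≡⟨ act-ascending (ps ++ y ∷ []) x xs zs (cong suc (length-∷ʳ ps y)) refl ⟩
    (ps ++ y ∷ []) ++ xs ++ x ∷ zs
  ≡⟨ ++-assoc ps (y ∷ []) _ ⟩
    ps ++ y ∷ xs ++ x ∷ zs
  ∎
  where
  open ≡-Reasoning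
  moves = ascending (suc (suc (length ps))) (length xs)

-- The tableau P(w^{(d,r)}) and its reading word

positives : ℕ → ℕ → List ℤ
positives a zero    = []
positives a (suc m) = + suc a ∷ positives (suc a) m

negatives : ℕ → ℕ → List ℤ
negatives a zero    = []
negatives a (suc m) = -[1+ a ] ∷ negatives (suc a) m

length-positives : ∀ a m → length (positives a m) ≡ m
length-positives a zero    = refl
length-positives a (suc m) = cong suc (length-positives (suc a) m)

length-negatives : ∀ a m → length (negatives a m) ≡ m
length-negatives a zero    = refl
length-negatives a (suc m) = cong suc (length-negatives (suc a) m)

positives-++ : ∀ a m e → positives a (m + e) ≡ positives a m ++ positives (a + m) e
positives-++ a zero    e = cong (λ b → positives b e) (sym (+-identityʳ a))
positives-++ a (suc m) e = cong (+ suc a ∷_)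
  (trans (positives-++ (suc a) m e) (cong (λ b → positives (suc a) m ++ positives b e) (sym (+-suc a m))))

positives-∷ʳ : ∀ a m → positives a m ++ + suc (a + m) ∷ [] ≡ positives a (suc m)
positives-∷ʳ a m = trans (sym (positives-++ a m 1)) (cong (positives a) (+-comm m 1))

negatives-∷ʳ : ∀ a m → negatives a m ++ -[1+ a + m ] ∷ [] ≡ negatives a (suc m)
negatives-∷ʳ a zero    = cong (λ b → -[1+ b ] ∷ []) (+-identityʳ a)
negatives-∷ʳ a (suc m) = cong (-[1+ a ] ∷_)
  (trans (cong (λ b → negatives (suc a) m ++ -[1+ b ] ∷ []) (+-suc a m)) (negatives-∷ʳ (suc a) m))

applyUpTo≡positives : ∀ (f : ℕ → ℤ) a m → (∀ i → f i ≡ + (a + suc i)) →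
  applyUpTo f m ≡ positives a m
applyUpTo≡positives f a zero    f≗ = refl
applyUpTo≡positives f a (suc m) f≗ = cong₂ _∷_ (trans (f≗ 0) (cong +_ (+-comm a 1)))
  (applyUpTo≡positives (f ∘ suc) (suc a) m (λ i → trans (f≗ (suc i)) (cong +_ (+-suc a (suc i)))))

applyUpTo≡negatives : ∀ (f : ℕ → ℤ) a m → (∀ i → f i ≡ -[1+ a + i ]) →
  applyUpTo f m ≡ negatives a m
applyUpTo≡negatives f a zero    f≗ = refl
applyUpTo≡negatives f a (suc m) f≗ = cong₂ _∷_ (trans (f≗ 0) (cong -[1+_] (+-identityʳ a)))
  (applyUpTo≡negatives (f ∘ suc) (suc a) m (λ i → trans (f≗ (suc i)) (cong -[1+_] (+-suc a i))))

idB≡positives : ∀ n → idB n ≡ positives 0 n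
idB≡positives n = applyUpTo≡positives _ 0 n (λ i → refl)

wdr≡positives++negatives : ∀ d r → wdr d r ≡ positives d r ++ negatives 0 d
wdr≡positives++negatives d r =
  cong₂ _++_ (applyUpTo≡positives _ d r (λ i → refl)) (applyUpTo≡negatives _ 0 d (λ i → refl))

P-row : ℕ → ℕ → List ℕ
P-row k r = descending r k ++ ascending 0 (suc (r + k))

P : ℕ → ℕ → Tableau
P zero    r = []
P (suc k) r = P-row k r ∷ P k r

P-word : ℕ → ℕ → List ℕ
P-word zero    r = []
P-word (suc k) r = P-word k r ++ P-row k r

length-P-row : ∀ k r → length (P-row k r) ≡ k + suc (r + k)
length-P-row k r = trans (length-++ (descending r k))
  (cong₂ _+_ (length-descending r k) (length-ascending 0 (suc (r + k))))

P-row-≤ : ∀ k r → All (_≤ r + k) (P-row k r)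
P-row-≤ k r = AllP.++⁺ (All.map proj₂ (descending-bounds r k))
                           (All.map ≤-pred (ascending-< 0 (suc (r + k))))

P-word-≤ : ∀ k r → All (_≤ r + k) (P-word (suc k) r)
P-word-≤ zero    r = P-row-≤ 0 r
P-word-≤ (suc k) r = AllP.++⁺
  (All.map (λ v≤ → ≤-trans v≤ (+-monoʳ-≤ r (n≤1+n k))) (P-word-≤ k r))
                                  (P-row-≤ (suc k) r)

P-row-unimodal : ∀ k r → Unimodal (P-row k r)
P-row-unimodal k r = descending r k , 0 , ascending 1 (r + k) , refl ,
  descending-decreasing r k , ascending-increasing 0 (suc (r + k))

readingWord-P : ∀ d r → readingWord (P d r) ≡ P-word d r
readingWord-P zero    r = refl
readingWord-P (suc k) r = begin
    concat (reverse (P-row k r ∷ P k r))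
  ≡⟨ cong concat (unfold-reverse (P-row k r) (P k r)) ⟩
    concat (reverse (P k r) ++ P-row k r ∷ [])
  ≡⟨ sym (concat-++ (reverse (P k r)) (P-row k r ∷ [])) ⟩
    concat (reverse (P k r)) ++ P-row k r ++ []
  ≡⟨ cong₂ _++_ (readingWord-P k r) (++-identityʳ (P-row k r)) ⟩
    P-word k r ++ P-row k r
  ∎ where open ≡-Reasoning

act-P-row : ∀ k r zs →
  act (positives k r ++ negatives 0 k ++ + suc (k + r) ∷ zs) (P-row k r) ≡
  positives (suc k) r ++ negatives 0 (suc k) ++ zs
act-P-row k r zs = begin
    act (Ps ++ Ns ++ + suc (k + r) ∷ zs) (descending r k ++ 0 ∷ ascending 1 (r + k))
  ≡⟨ act-++ _ (descending r k) _ ⟩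
    act (act (Ps ++ Ns ++ + suc (k + r) ∷ zs) (descending r k)) (0 ∷ ascending 1 (r + k))
  ≡⟨ cong (λ w → act w (0 ∷ ascending 1 (r + k)))
       (act-descending Ps Ns _ zs (length-positives k r) (length-negatives 0 k)) ⟩
    act (Ps ++ + suc (k + r) ∷ Ns ++ zs) (0 ∷ ascending 1 (r + k))
  ≡⟨ cong (λ w → act w (0 ∷ ascending 1 (r + k)))
       (trans (sym (++-assoc Ps _ (Ns ++ zs))) (cong (_++ Ns ++ zs) (positives-∷ʳ k r))) ⟩
    act (-[1+ k ] ∷ positives (suc k) r ++ Ns ++ zs) (ascending 1 (r + k))
  ≡⟨ cong (λ w → act (-[1+ k ] ∷ w) (ascending 1 (r + k))) (sym (++-assoc _ Ns zs)) ⟩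
    act (-[1+ k ] ∷ (positives (suc k) r ++ Ns) ++ zs) (ascending 1 (r + k))
  ≡⟨ act-ascending [] -[1+ k ] (positives (suc k) r ++ Ns) zs refl length-moved ⟩
    (positives (suc k) r ++ Ns) ++ -[1+ k ] ∷ zs
  ≡⟨ ++-assoc (positives (suc k) r) Ns _ ⟩
    positives (suc k) r ++ Ns ++ -[1+ k ] ∷ zs
  ≡⟨ cong (positives (suc k) r ++_)
       (trans (sym (++-assoc Ns _ zs)) (cong (_++ zs) (negatives-∷ʳ 0 k))) ⟩
    positives (suc k) r ++ negatives 0 (suc k) ++ zs
  ∎
  where
  open ≡-Reasoning
  Ps = positives k r
  Ns = negatives 0 k
  length-moved : length (positives (suc k) r ++ Ns) ≡ r + k
  length-moved = trans (length-++ (positives (suc k) r))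
    (cong₂ _+_ (length-positives (suc k) r) (length-negatives 0 k))

act-P-word : ∀ k r e →
  act (positives 0 (k + r + e)) (P-word k r) ≡ positives k r ++ negatives 0 k ++ positives (k + r) e
act-P-word zero    r e = positives-++ 0 r e
act-P-word (suc k) r e = begin
    act (positives 0 (suc (k + r + e))) (P-word k r ++ P-row k r)
  ≡⟨ act-++ _ (P-word k r) (P-row k r) ⟩
    act (act (positives 0 (suc (k + r + e))) (P-word k r)) (P-row k r)
  ≡⟨ cong (λ n → act (act (positives 0 n) (P-word k r)) (P-row k r)) (sym (+-suc (k + r) e)) ⟩
    act (act (positives 0 (k + r + suc e)) (P-word k r)) (P-row k r)
  ≡⟨ cong (λ w → act w (P-row k r)) (act-P-word k r (suc e)) ⟩
    act (positives k r ++ negatives 0 k ++ positives (k + r) (suc e)) (P-row k r)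
  ≡⟨ act-P-row k r _ ⟩
    positives (suc k) r ++ negatives 0 (suc k) ++ positives (suc k + r) e
  ∎ where open ≡-Reasoning

act-P-word-idB : ∀ d r → act (idB (d + r)) (P-word d r) ≡ wdr d r
act-P-word-idB d r = begin
    act (idB (d + r)) (P-word d r)
  ≡⟨ cong (λ w → act w (P-word d r))
       (trans (idB≡positives (d + r)) (cong (positives 0) (sym (+-identityʳ (d + r))))) ⟩
    act (positives 0 (d + r + 0)) (P-word d r)
  ≡⟨ act-P-word d r 0 ⟩
    positives d r ++ negatives 0 d ++ []
  ≡⟨ cong (positives d r ++_) (++-identityʳ (negatives 0 d)) ⟩
    positives d r ++ negatives 0 d
  ≡⟨ sym (wdr≡positives++negatives d r) ⟩
    wdr d r
  ∎ where open ≡-Reasoning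

-- The type-B length  ℓ(w) = #{i<j : w(j) < w(i)} + #{i<j : w(j) < -w(i)} + #{i : w(i) < 0}

χ< : ℤ → ℤ → ℕ
χ< a b with a ℤ.<? b
... | yes _ = 1
... | no  _ = 0

χ<-≤1 : ∀ a b → χ< a b ≤ 1
χ<-≤1 a b with a ℤ.<? b
... | yes _ = s≤s z≤n
... | no  _ = z≤n

χ<-yes : ∀ a b → a ℤ.< b → χ< a b ≡ 1
χ<-yes a b a<b with a ℤ.<? b
... | yes _   = refl
... | no  a≮b = contradiction a<b a≮b

χ<-no : ∀ a b → ¬ (a ℤ.< b) → χ< a b ≡ 0
χ<-no a b a≮b with a ℤ.<? b
... | yes a<b = contradiction a<b a≮b
... | no  _   = refl

<-neg-flip : ∀ {x y} → x ℤ.< ℤ.- y → y ℤ.< ℤ.- x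
<-neg-flip {x} {y} x<-y = subst (ℤ._< ℤ.- x) (ℤP.neg-involutive y) (ℤP.neg-mono-< x<-y)

χ<-neg-flip : ∀ x y → χ< x (ℤ.- y) ≡ χ< y (ℤ.- x)
χ<-neg-flip x y with x ℤ.<? ℤ.- y | y ℤ.<? ℤ.- x
... | yes _ | yes _ = refl
... | no  _ | no  _ = refl
... | yes p | no  q = contradiction (<-neg-flip p) q
... | no  q | yes p = contradiction (<-neg-flip p) q

inversion : ℤ → ℤ → ℕ
inversion x y = χ< y x + χ< y (ℤ.- x)

inversions : ℤ → List ℤ → ℕ
inversions x []       = 0
inversions x (y ∷ ys) = inversion x y + inversions x ys

negative : ℤ → ℕ
negative x = χ< x (+ 0)

lengthB : List ℤ → ℕ
lengthB []       = 0
lengthB (x ∷ xs) = inversions x xs + negative x + lengthB xs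

inversion-neg : ∀ x y → inversion (ℤ.- x) y ≡ inversion x y
inversion-neg x y = trans (cong (λ t → χ< y (ℤ.- x) + χ< y t) (ℤP.neg-involutive x))
                          (+-comm (χ< y (ℤ.- x)) (χ< y x))

inversions-neg : ∀ x ys → inversions (ℤ.- x) ys ≡ inversions x ys
inversions-neg x []       = refl
inversions-neg x (y ∷ ys) = cong₂ _+_ (inversion-neg x y) (inversions-neg x ys)

inversions-swapAt : ∀ x k ys → inversions x (swapAt k ys) ≡ inversions x ys
inversions-swapAt x zero          ys           = refl
inversions-swapAt x (suc zero)    []           = refl
inversions-swapAt x (suc zero)    (y ∷ [])     = refl
inversions-swapAt x (suc zero)    (y ∷ z ∷ ys) =
  x+[y+z]≡y+[x+z] (inversion x z) (inversion x y) (inversions x ys)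
  where
  x+[y+z]≡y+[x+z] : ∀ a b c → a + (b + c) ≡ b + (a + c)
  x+[y+z]≡y+[x+z] = solve-∀
inversions-swapAt x (suc (suc k)) []           = refl
inversions-swapAt x (suc (suc k)) (y ∷ ys)     =
  cong (λ t → inversion x y + t) (inversions-swapAt x (suc k) ys)

inversions-++ : ∀ x ys zs → inversions x (ys ++ zs) ≡ inversions x ys + inversions x zs
inversions-++ x []       zs = refl
inversions-++ x (y ∷ ys) zs =
  trans (cong (λ t → inversion x y + t) (inversions-++ x ys zs)) (sym (+-assoc (inversion x y) _ _))

inversion-swap : ∀ x y → inversion y x ≤ suc (inversion x y)
inversion-swap x y = begin
    χ< x y + χ< x (ℤ.- y)
  ≡⟨ cong (λ t → χ< x y + t) (χ<-neg-flip x y) ⟩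
    χ< x y + χ< y (ℤ.- x)
  ≤⟨ +-monoˡ-≤ (χ< y (ℤ.- x)) (χ<-≤1 x y) ⟩
    suc (χ< y (ℤ.- x))
  ≤⟨ s≤s (m≤n+m (χ< y (ℤ.- x)) (χ< y x)) ⟩
    suc (χ< y x + χ< y (ℤ.- x))
  ∎ where open ≤-Reasoning

lengthB-swapAt : ∀ k w → lengthB (swapAt k w) ≤ suc (lengthB w)
lengthB-swapAt zero          w            = n≤1+n _
lengthB-swapAt (suc zero)    []           = z≤n
lengthB-swapAt (suc zero)    (x ∷ [])     = n≤1+n _
lengthB-swapAt (suc zero)    (x ∷ y ∷ xs) = begin
    (inversion y x + inversions y xs) + negative y + (inversions x xs + negative x + lengthB xs)
  ≡⟨ reassociate (inversion y x) (inversions y xs) (negative y) (inversions x xs) (negative x) _ ⟩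
    inversion y x + rest
  ≤⟨ +-monoˡ-≤ rest (inversion-swap x y) ⟩
    suc (inversion x y + rest)
  ≡⟨ cong suc (sym (reassociate′ (inversion x y) (inversions y xs) (negative y) (inversions x xs) _ _)) ⟩
    suc ((inversion x y + inversions x xs) + negative x + (inversions y xs + negative y + lengthB xs))
  ∎
  where
  open ≤-Reasoning
  rest = inversions y xs + negative y + inversions x xs + negative x + lengthB xs
  reassociate : ∀ a b c d e f → (a + b) + c + (d + e + f) ≡ a + (b + c + d + e + f)
  reassociate = solve-∀
  reassociate′ : ∀ a b c d e f → (a + d) + e + (b + c + f) ≡ a + (b + c + d + e + f)
  reassociate′ = solve-∀
lengthB-swapAt (suc (suc k)) []           = z≤n
lengthB-swapAt (suc (suc k)) (x ∷ xs)     = begin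
    inversions x (swapAt (suc k) xs) + negative x + lengthB (swapAt (suc k) xs)
  ≡⟨ cong (λ t → t + negative x + lengthB (swapAt (suc k) xs)) (inversions-swapAt x (suc k) xs) ⟩
    inversions x xs + negative x + lengthB (swapAt (suc k) xs)
  ≤⟨ +-monoʳ-≤ (inversions x xs + negative x) (lengthB-swapAt (suc k) xs) ⟩
    inversions x xs + negative x + suc (lengthB xs)
  ≡⟨ +-suc (inversions x xs + negative x) (lengthB xs) ⟩
    suc (inversions x xs + negative x + lengthB xs)
  ∎ where open ≤-Reasoning

lengthB-rmul : ∀ w a → lengthB (rmul w a) ≤ suc (lengthB w)
lengthB-rmul []       zero    = z≤n
lengthB-rmul (x ∷ xs) zero    = begin
    inversions (ℤ.- x) xs + negative (ℤ.- x) + lengthB xs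
  ≡⟨ cong (λ t → t + negative (ℤ.- x) + lengthB xs) (inversions-neg x xs) ⟩
    inversions x xs + negative (ℤ.- x) + lengthB xs
  ≤⟨ +-monoˡ-≤ (lengthB xs) (+-monoʳ-≤ (inversions x xs) (≤-trans (χ<-≤1 _ _) (s≤s z≤n))) ⟩
    inversions x xs + suc (negative x) + lengthB xs
  ≡⟨ cong (_+ lengthB xs) (+-suc (inversions x xs) (negative x)) ⟩
    suc (inversions x xs + negative x + lengthB xs)
  ∎ where open ≤-Reasoning
lengthB-rmul w        (suc k) = lengthB-swapAt (suc k) w

lengthB-act : ∀ w as → lengthB (act w as) ≤ lengthB w + length as
lengthB-act w []       = m≤m+n _ 0
lengthB-act w (a ∷ as) = begin
    lengthB (act (rmul w a) as)
  ≤⟨ lengthB-act (rmul w a) as ⟩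
    lengthB (rmul w a) + length as
  ≤⟨ +-monoˡ-≤ (length as) (lengthB-rmul w a) ⟩
    suc (lengthB w) + length as
  ≡⟨ sym (+-suc (lengthB w) (length as)) ⟩
    lengthB w + suc (length as)
  ∎ where open ≤-Reasoning

inversions-positive-positives : ∀ a c m → a < c → inversions (+ suc a) (positives c m) ≡ 0
inversions-positive-positives a c zero    a<c = refl
inversions-positive-positives a c (suc m) a<c = begin
    χ< (+ suc c) (+ suc a) + χ< (+ suc c) -[1+ a ] + inversions (+ suc a) (positives (suc c) m)
  ≡⟨ cong₂ (λ u v → u + v + inversions (+ suc a) (positives (suc c) m))
       (χ<-no (+ suc c) (+ suc a) λ { (ℤ.+<+ c<a) → <-asym a<c (≤-pred c<a) })
       (χ<-no (+ suc c) -[1+ a ] λ ()) ⟩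
    inversions (+ suc a) (positives (suc c) m)
  ≡⟨ inversions-positive-positives a (suc c) m (m<n⇒m<1+n a<c) ⟩
    0
  ∎ where open ≡-Reasoning

inversions-positive-negatives : ∀ a c m → c + m ≤ suc a → inversions (+ suc a) (negatives c m) ≡ m
inversions-positive-negatives a c zero    c+m≤a = refl
inversions-positive-negatives a c (suc m) c+m≤a = begin
    χ< -[1+ c ] (+ suc a) + χ< -[1+ c ] -[1+ a ] + inversions (+ suc a) (negatives (suc c) m)
  ≡⟨ cong₂ (λ u v → u + v + inversions (+ suc a) (negatives (suc c) m))
       (χ<-yes -[1+ c ] (+ suc a) ℤ.-<+)
       (χ<-no -[1+ c ] -[1+ a ] λ { (ℤ.-<- a<c) → <-irrefl refl (<-≤-trans a<c c≤a) }) ⟩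
    suc (inversions (+ suc a) (negatives (suc c) m))
  ≡⟨ cong suc (inversions-positive-negatives a (suc c) m c+m≤a′) ⟩
    suc m
  ∎
  where
  open ≡-Reasoning
  c+m≤a′ : suc c + m ≤ suc a
  c+m≤a′ = subst (_≤ suc a) (+-suc c m) c+m≤a
  c≤a : c ≤ a
  c≤a = ≤-pred (≤-trans (s≤s (m≤m+n c m)) c+m≤a′)

inversions-negative-negatives : ∀ a c m → a < c → inversions -[1+ a ] (negatives c m) ≡ m + m
inversions-negative-negatives a c zero    a<c = refl
inversions-negative-negatives a c (suc m) a<c = begin
    χ< -[1+ c ] -[1+ a ] + χ< -[1+ c ] (+ suc a) + inversions -[1+ a ] (negatives (suc c) m)
  ≡⟨ cong₂ (λ u v → u + v + inversions -[1+ a ] (negatives (suc c) m))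
       (χ<-yes -[1+ c ] -[1+ a ] (ℤ.-<- a<c)) (χ<-yes -[1+ c ] (+ suc a) ℤ.-<+) ⟩
    2 + inversions -[1+ a ] (negatives (suc c) m)
  ≡⟨ cong (λ t → 2 + t) (inversions-negative-negatives a (suc c) m (m<n⇒m<1+n a<c)) ⟩
    2 + (m + m)
  ≡⟨ cong suc (sym (+-suc m m)) ⟩
    suc m + suc m
  ∎ where open ≡-Reasoning

lengthB-positives : ∀ a m → lengthB (positives a m) ≡ 0
lengthB-positives a zero    = refl
lengthB-positives a (suc m) =
  cong₂ (λ u v → u + negative (+ suc a) + v)
    (inversions-positive-positives a (suc a) m (n<1+n a)) (lengthB-positives (suc a) m)

lengthB-negatives : ∀ a m → lengthB (negatives a m) ≡ m * m
lengthB-negatives a zero    = refl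
lengthB-negatives a (suc m) = begin
    inversions -[1+ a ] (negatives (suc a) m) + negative -[1+ a ] + lengthB (negatives (suc a) m)
  ≡⟨ cong₂ (λ u v → u + v + lengthB (negatives (suc a) m))
       (inversions-negative-negatives a (suc a) m (n<1+n a)) (χ<-yes -[1+ a ] (+ 0) ℤ.-<+) ⟩
    m + m + 1 + lengthB (negatives (suc a) m)
  ≡⟨ cong (λ t → m + m + 1 + t) (lengthB-negatives (suc a) m) ⟩
    m + m + 1 + m * m
  ≡⟨ square-suc m ⟩
    suc m * suc m
  ∎
  where
  open ≡-Reasoning
  square-suc : ∀ x → x + x + 1 + x * x ≡ (1 + x) * (1 + x)
  square-suc = solve-∀

lengthB-positives++negatives : ∀ a m c n → c + n ≤ suc a →
  lengthB (positives a m ++ negatives c n) ≡ m * n + n * n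
lengthB-positives++negatives a zero    c n c+n≤a = lengthB-negatives c n
lengthB-positives++negatives a (suc m) c n c+n≤a = begin
    inversions (+ suc a) (positives (suc a) m ++ negatives c n) + negative (+ suc a) + lengthB rest
  ≡⟨ cong₂ (λ u v → u + v + lengthB rest)
       (inversions-++ (+ suc a) (positives (suc a) m) (negatives c n))
       (χ<-no (+ suc a) (+ 0) λ { (ℤ.+<+ ()) }) ⟩
    inversions (+ suc a) (positives (suc a) m) + inversions (+ suc a) (negatives c n) + 0 + lengthB rest
  ≡⟨ cong₂ (λ u v → u + v + 0 + lengthB rest)
       (inversions-positive-positives a (suc a) m (n<1+n a)) (inversions-positive-negatives a c n c+n≤a) ⟩
    n + 0 + lengthB rest
  ≡⟨ cong (λ t → n + 0 + t) (lengthB-positives++negatives (suc a) m c n (m≤n⇒m≤1+n c+n≤a)) ⟩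
    n + 0 + (m * n + n * n)
  ≡⟨ collect n (m * n) (n * n) ⟩
    suc m * n + n * n
  ∎
  where
  open ≡-Reasoning
  rest = positives (suc a) m ++ negatives c n
  collect : ∀ x y z → x + 0 + (y + z) ≡ (x + y) + z
  collect = solve-∀

lengthB-wdr : ∀ d r → lengthB (wdr d r) ≡ r * d + d * d
lengthB-wdr d r = trans (cong lengthB (wdr≡positives++negatives d r))
                        (lengthB-positives++negatives d r 0 d (n≤1+n d))

wdr-word-length-≥ : ∀ n d r as → act (idB n) as ≡ wdr d r → r * d + d * d ≤ length as
wdr-word-length-≥ n d r as act≡wdr = begin
    r * d + d * d
  ≡⟨ sym (lengthB-wdr d r) ⟩
    lengthB (wdr d r)
  ≡⟨ cong lengthB (sym act≡wdr) ⟩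
    lengthB (act (idB n) as)
  ≤⟨ lengthB-act (idB n) as ⟩
    lengthB (idB n) + length as
  ≡⟨ cong (λ w → lengthB w + length as) (idB≡positives n) ⟩
    lengthB (positives 0 n) + length as
  ≡⟨ cong (_+ length as) (lengthB-positives 0 n) ⟩
    length as
  ∎ where open ≤-Reasoning

-- Longest unimodal subsequences

⊆-map⁻ : ∀ {A B : Set} {f : A → B} {c} xs → c ⊆ map f xs →
  Σ (List A) λ ys → ys ⊆ xs × map f ys ≡ c
⊆-map⁻ []       []          = [] , [] , refl
⊆-map⁻ (x ∷ xs) (_ ∷ʳ c⊆)   with ⊆-map⁻ xs c⊆
... | ys , ys⊆ , refl = ys , x ∷ʳ ys⊆ , refl
⊆-map⁻ (x ∷ xs) (refl ∷ c⊆) with ⊆-map⁻ xs c⊆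
... | ys , ys⊆ , refl = x ∷ ys , refl ∷ ys⊆ , refl

AllPairs-resp-⊆ : ∀ {A : Set} {R : A → A → Set} {xs ys} →
  ys ⊆ xs → AllPairs R xs → AllPairs R ys
AllPairs-resp-⊆ []           []         = []
AllPairs-resp-⊆ (_ ∷ʳ ys⊆)   (_ ∷ Rxs)  = AllPairs-resp-⊆ ys⊆ Rxs
AllPairs-resp-⊆ (refl ∷ ys⊆) (Rx ∷ Rxs) = All-resp-⊆ ys⊆ Rx ∷ AllPairs-resp-⊆ ys⊆ Rxs

AllPairs-++⁺-universalˡ : ∀ {A : Set} {R : A → A → Set} {xs ys} →
  All (λ x → ∀ y → R x y) xs → AllPairs R ys → AllPairs R (xs ++ ys)
AllPairs-++⁺-universalˡ []         Rys = Rys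
AllPairs-++⁺-universalˡ (Rx ∷ Rxs) Rys = All.universal Rx _ ∷ AllPairs-++⁺-universalˡ Rxs Rys

increasing-length+head≤ : ∀ {M a ys} → Linked _<_ (a ∷ ys) → All (_≤ M) (a ∷ ys) →
  length ys + a ≤ M
increasing-length+head≤ {ys = []}     [-]            (a≤M ∷ []) = a≤M
increasing-length+head≤ {ys = y ∷ ys} (a<y ∷ <-ys) (_ ∷ ≤M)   = begin
    suc (length ys) + _
  ≡⟨ sym (+-suc (length ys) _) ⟩
    length ys + suc _
  ≤⟨ +-monoʳ-≤ (length ys) a<y ⟩
    length ys + y
  ≤⟨ increasing-length+head≤ <-ys ≤M ⟩
    _
  ∎ where open ≤-Reasoning

Descends : ℕ × ℕ → ℕ × ℕ → Set
Descends (v , l) (w , m) = w < v → l < m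

decreasing⇒labels-increasing : ∀ {ls} → AllPairs Descends ls → Linked _>_ (map proj₁ ls) →
  Linked _<_ (map proj₂ ls)
decreasing⇒labels-increasing {[]}          _                  _          = []
decreasing⇒labels-increasing {_ ∷ []}      _                  _          = [-]
decreasing⇒labels-increasing {_ ∷ _ ∷ _}   ((d ∷ _) ∷ ds)   (v>w ∷ >s) =
  d v>w ∷ decreasing⇒labels-increasing ds >s

decreasing-sublist-length : ∀ K ls c → AllPairs Descends ls → All ((_≤ K) ∘ proj₂) ls →
  c ⊆ map proj₁ ls → Linked _>_ c → length c ≤ suc K
decreasing-sublist-length K ls c descends ≤K c⊆ >c with ⊆-map⁻ ls c⊆
... | [] , _ , refl = z≤n
... | (_ , l) ∷ ys , ys⊆ , refl = s≤s (begin
    length (map proj₁ ys)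
  ≡⟨ trans (length-map proj₁ ys) (sym (length-map proj₂ ys)) ⟩
    length (map proj₂ ys)
  ≤⟨ m≤m+n _ l ⟩
    length (map proj₂ ys) + l
  ≤⟨ increasing-length+head≤ (decreasing⇒labels-increasing (AllPairs-resp-⊆ ys⊆ descends) >c)
                             (AllP.map⁺ (All-resp-⊆ ys⊆ ≤K)) ⟩
    K
  ∎) where open ≤-Reasoning

module Labelling (r : ℕ) where

  label : ℕ → ℕ → ℕ
  label k v = k ⊓ (r + k ∸ v)

  labelled-row : ℕ → List (ℕ × ℕ)
  labelled-row k = map (λ v → v , label k v) (P-row k r)

  labelled-word : ℕ → List (ℕ × ℕ)
  labelled-word zero    = []
  labelled-word (suc k) = labelled-word k ++ labelled-row k

  values-labelled-word : ∀ k → map proj₁ (labelled-word k) ≡ P-word k r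
  values-labelled-word zero    = refl
  values-labelled-word (suc k) = begin
      map proj₁ (labelled-word k ++ labelled-row k)
    ≡⟨ map-++ proj₁ (labelled-word k) (labelled-row k) ⟩
      map proj₁ (labelled-word k) ++ map proj₁ (labelled-row k)
    ≡⟨ cong₂ _++_ (values-labelled-word k) (trans (sym (map-∘ (P-row k r))) (map-id (P-row k r))) ⟩
      P-word k r ++ P-row k r
    ∎ where open ≡-Reasoning

  Below : ℕ → ℕ × ℕ → Set
  Below k (v , l) = l < k × l + v ≤ r + k

  Below-label : ∀ {k l v w} → Below k (v , l) → w < v → l < label k w
  Below-label {k} {l} {v} {w} (l<k , l+v≤) w<v =
    ⊓-glb l<k (m+n≤o⇒m≤o∸n (suc l) (≤-trans (+-monoʳ-< l w<v) l+v≤))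

  label-≤ : ∀ k v → label k v ≤ k
  label-≤ k v = m⊓n≤m k _

  label+value-≤ : ∀ k {v} → v ≤ r + k → label k v + v ≤ r + k
  label+value-≤ k {v} v≤ = ≤-trans (+-monoˡ-≤ v (m⊓n≤n k _)) (≤-reflexive (m∸n+n≡m v≤))

  Below-descending : ∀ k {v} → r < v → v ≤ r + k → Below k (v , label k v)
  Below-descending k {v} r<v v≤ =
    ≤-<-trans (m⊓n≤n k _) (subst (r + k ∸ v <_) (m+n∸m≡n r k) (∸-monoʳ-< r<v v≤)) ,
    label+value-≤ k v≤

  labelled-row-descends : ∀ k → AllPairs Descends (labelled-row k)
  labelled-row-descends k = AllPairs.map⁺ (AllPairs-++⁺-universalˡ
    (All.map (λ (r<v , v≤) _ w<v → Below-label (Below-descending k r<v v≤) w<v) (descending-bounds r k))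
    (AllPairs.map (λ v<w w<v → contradiction v<w (<-asym w<v))
                  (Linked⇒AllPairs <-trans (ascending-increasing 0 _))))

  labelled-word-Below : ∀ k → All (Below k) (labelled-word k)
  labelled-word-Below zero    = []
  labelled-word-Below (suc k) = AllP.++⁺
    (All.map (λ (l<k , l+v≤) → m<n⇒m<1+n l<k , ≤-trans l+v≤ r+k≤r+1+k) (labelled-word-Below k))
    (AllP.map⁺ (All.map (λ {v} v≤ → s≤s (label-≤ k v) , ≤-trans (label+value-≤ k v≤) r+k≤r+1+k)
                        (P-row-≤ k r)))
    where
    r+k≤r+1+k : r + k ≤ r + suc k
    r+k≤r+1+k = +-monoʳ-≤ r (n≤1+n k)

  labelled-word-descends : ∀ k → AllPairs Descends (labelled-word k)
  labelled-word-descends zero    = []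
  labelled-word-descends (suc k) = AllPairs.++⁺ (labelled-word-descends k) (labelled-row-descends k)
    (All.map (λ {(_ , _)} below → AllP.map⁺ (All.universal (λ _ → Below-label below) (P-row k r)))
             (labelled-word-Below k))

  labelled-word-labels : ∀ k → All ((_≤ k) ∘ proj₂) (labelled-word (suc k))
  labelled-word-labels k = All.map (λ (l<k , _) → ≤-pred l<k) (labelled-word-Below (suc k))

unimodal-length-≤ : ∀ k r u → u ⊆ P-word (suc k) r → Unimodal u → length u ≤ length (P-row k r)
unimodal-length-≤ k r _ u⊆ (xs , a , ys , refl , >xs , <ys) = begin
    length (xs ++ a ∷ ys)
  ≡⟨ trans (cong length (sym (++-assoc xs (a ∷ []) ys))) (length-++ (xs ++ a ∷ [])) ⟩
    length (xs ++ a ∷ []) + length ys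
  ≤⟨ +-mono-≤ decreasing-part (m+n≤o⇒m≤o (length ys) increasing-part) ⟩
    suc k + (r + k)
  ≡⟨ sym (+-suc k (r + k)) ⟩
    k + suc (r + k)
  ≡⟨ sym (length-P-row k r) ⟩
    length (P-row k r)
  ∎
  where
  open ≤-Reasoning
  open Labelling r
  decreasing-part : length (xs ++ a ∷ []) ≤ suc k
  decreasing-part = decreasing-sublist-length k (labelled-word (suc k)) (xs ++ a ∷ [])
    (labelled-word-descends (suc k)) (labelled-word-labels k)
    (subst (xs ++ a ∷ [] ⊆_) (sym (values-labelled-word (suc k)))
           (⊆-trans (++⁺ ⊆-refl (refl ∷ minimum ys)) u⊆))
    >xs
  increasing-part : length ys + a ≤ r + k
  increasing-part =
    increasing-length+head≤ <ys (All-resp-⊆ (⊆-trans (++⁺ˡ xs ⊆-refl) u⊆) (P-word-≤ k r))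

rowConditions-P : ∀ d r → RowConditions (P d r)
rowConditions-P zero    r = tt
rowConditions-P (suc k) r = P-row-unimodal k r
  , subst (IsMaxUnimodalLength (length (P-row k r))) (sym (readingWord-P (suc k) r))
      ((P-row k r , ++⁺ˡ (P-word k r) ⊆-refl , P-row-unimodal k r , refl) , unimodal-length-≤ k r)
  , rowConditions-P k r

-- Shape and entries

shape-P : ∀ d r → shape (P d r) ≡ Z d r
shape-P zero    r = refl
shape-P (suc k) r = cong₂ _∷_ (trans (length-P-row k r) (rearrange r k)) (shape-P k r)
  where
  rearrange : ∀ r k → k + (1 + (r + k)) ≡ r + 2 * k + 1
  rearrange = solve-∀

Z-strictPartition : ∀ d r → IsStrictPartition (Z d r)
Z-strictPartition d r = decreasing d , positive d
  where
  decreasing : ∀ d → Linked _>_ (Z d r)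
  decreasing zero          = []
  decreasing (suc zero)    = [-]
  decreasing (suc (suc k)) =
    subst (_> r + 2 * k + 1) (sym (next-part r k)) (m<n+m _ {2} (s≤s z≤n)) ∷ decreasing (suc k)
    where
    next-part : ∀ r k → r + 2 * (1 + k) + 1 ≡ 1 + (1 + (r + 2 * k + 1))
    next-part = solve-∀
  positive : ∀ d → All (0 <_) (Z d r)
  positive zero    = []
  positive (suc k) = subst (0 <_) (sym (+-comm (r + 2 * k) 1)) (s≤s z≤n) ∷ positive k

length-P-word : ∀ d r → length (P-word d r) ≡ r * d + d * d
length-P-word zero    r = sym (trans (+-identityʳ (r * 0)) (*-zeroʳ r))
length-P-word (suc k) r = begin
    length (P-word k r ++ P-row k r)
  ≡⟨ length-++ (P-word k r) ⟩
    length (P-word k r) + length (P-row k r)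
  ≡⟨ cong₂ _+_ (length-P-word k r) (length-P-row k r) ⟩
    r * k + k * k + (k + suc (r + k))
  ≡⟨ expand r k ⟩
    r * suc k + suc k * suc k
  ∎
  where
  open ≡-Reasoning
  expand : ∀ r k → r * k + k * k + (k + (1 + (r + k))) ≡ r * (1 + k) + (1 + k) * (1 + k)
  expand = solve-∀

P-word-< : ∀ d r → All (_< d + r) (P-word d r)
P-word-< zero    r = []
P-word-< (suc k) r = All.map (λ v≤ → s≤s (≤-trans v≤ (≤-reflexive (+-comm r k)))) (P-word-≤ k r)

isSDT-P : ∀ d r → IsSDT (d + r) (wdr d r) (P d r)
isSDT-P d r = subst IsStrictPartition (sym (shape-P d r)) (Z-strictPartition d r)
  , subst (IsReduced (d + r) (wdr d r)) (sym (readingWord-P d r))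
      ( (P-word-< d r , act-P-word-idB d r)
      , λ as (_ , act≡wdr) →
          subst (_≤ length as) (sym (length-P-word d r)) (wdr-word-length-≥ (d + r) d r as act≡wdr))
  , rowConditions-P d r

nth-Z : ∀ d r i {x} → nth (Z d r) i ≡ just x → Σ ℕ λ k → d ≡ i + suc k × x ≡ r + 2 * k + 1
nth-Z (suc d) r zero    refl = d , refl , refl
nth-Z (suc d) r (suc i) eq with nth-Z d r i eq
... | k , refl , x≡ = k , refl , x≡

nth-P : ∀ i k r → nth (P (i + suc k) r) i ≡ just (P-row k r)
nth-P zero    k r = refl
nth-P (suc i) k r = nth-P i k r

length-P : ∀ d r → length (P d r) ≡ d
length-P zero    r = refl
length-P (suc d) r = cong suc (length-P d r)

length-Z : ∀ d r → length (Z d r) ≡ d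
length-Z zero    r = refl
length-Z (suc d) r = cong suc (length-Z d r)

nth-++ˡ : ∀ {A : Set} (xs ys : List A) {p} → p < length xs → nth (xs ++ ys) p ≡ nth xs p
nth-++ˡ (x ∷ xs) ys {zero}  _         = refl
nth-++ˡ (x ∷ xs) ys {suc p} (s≤s p<n) = nth-++ˡ xs ys p<n

nth-++ʳ : ∀ {A : Set} (xs ys : List A) p → nth (xs ++ ys) (length xs + p) ≡ nth ys p
nth-++ʳ []       ys p = refl
nth-++ʳ (x ∷ xs) ys p = nth-++ʳ xs ys p

nth-ascending : ∀ a n {p} → p < n → nth (ascending a n) p ≡ just (a + p)
nth-ascending a (suc n) {zero}  _         = cong just (sym (+-identityʳ a))
nth-ascending a (suc n) {suc p} (s≤s p<n) = trans (nth-ascending (suc a) n p<n) (cong just (sym (+-suc a p)))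

nth-descending : ∀ a p n → nth (descending a (p + suc n)) p ≡ just (a + suc n)
nth-descending a zero    n = refl
nth-descending a (suc p) n = nth-descending a p n

entry-via-nth : ∀ T i j p {row} → j ℤ.- (+ suc i ℤ.- + length T) ≡ + p → nth T i ≡ just row →
  entry T (suc i) j ≡ nth row p
entry-via-nth T i j p offset≡ row≡ with j ℤ.- (+ suc i ℤ.- + length T) | nth T i | offset≡ | row≡
... | _ | _ | refl | refl = refl

-- Row i+1 of a shifted shape with i+1+k rows occupies the columns -k, …, λ_{i+1} - k - 1.
first-column : ∀ i k → + suc i ℤ.- + (i + suc k) ≡ ℤ.- (+ k)
first-column i k = begin
    + suc i ℤ.- + (i + suc k)
  ≡⟨ cong (λ t → + suc i ℤ.- t) rows-as-ℤ ⟩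
    + suc i ℤ.- (+ i ℤ.+ (+ 1 ℤ.+ + k))
  ≡⟨ cong (ℤ._- (+ i ℤ.+ (+ 1 ℤ.+ + k))) (ℤP.pos-+ 1 i) ⟩
    (+ 1 ℤ.+ + i) ℤ.- (+ i ℤ.+ (+ 1 ℤ.+ + k))
  ≡⟨ simplify (+ i) (+ k) ⟩
    ℤ.- (+ k)
  ∎
  where
  open ≡-Reasoning
  simplify : ∀ I K → (+ 1 ℤ.+ I) ℤ.- (I ℤ.+ (+ 1 ℤ.+ K)) ≡ ℤ.- K
  simplify = ℤSolver.solve-∀
  rows-as-ℤ : + (i + suc k) ≡ + i ℤ.+ (+ 1 ℤ.+ + k)
  rows-as-ℤ = trans (ℤP.pos-+ i (suc k)) (cong (λ t → + i ℤ.+ t) (ℤP.pos-+ 1 k))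

last-column : ∀ r i k → + (r + 2 * k + 1) ℤ.- + (i + suc k) ℤ.+ + suc i ℤ.- + 1 ≡ + (r + k)
last-column r i k = begin
    + (r + 2 * k + 1) ℤ.- + (i + suc k) ℤ.+ + suc i ℤ.- + 1
  ≡⟨ cong₂ (λ a b → a ℤ.- b ℤ.+ + suc i ℤ.- + 1) part-as-ℤ rows-as-ℤ ⟩
    (+ r ℤ.+ + 2 ℤ.* + k ℤ.+ + 1) ℤ.- (+ i ℤ.+ (+ 1 ℤ.+ + k)) ℤ.+ (+ 1 ℤ.+ + i) ℤ.- + 1
  ≡⟨ simplify (+ r) (+ i) (+ k) ⟩
    + r ℤ.+ + k
  ≡⟨ sym (ℤP.pos-+ r k) ⟩
    + (r + k)
  ∎
  where
  open ≡-Reasoning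
  part-as-ℤ : + (r + 2 * k + 1) ≡ + r ℤ.+ + 2 ℤ.* + k ℤ.+ + 1
  part-as-ℤ = trans (ℤP.pos-+ (r + 2 * k) 1)
    (cong (λ t → t ℤ.+ + 1) (trans (ℤP.pos-+ r (2 * k)) (cong (λ t → + r ℤ.+ t) (ℤP.pos-* 2 k))))
  rows-as-ℤ : + (i + suc k) ≡ + i ℤ.+ (+ 1 ℤ.+ + k)
  rows-as-ℤ = trans (ℤP.pos-+ i (suc k)) (cong (λ t → + i ℤ.+ t) (ℤP.pos-+ 1 k))
  simplify : ∀ R I K →
    (R ℤ.+ + 2 ℤ.* K ℤ.+ + 1) ℤ.- (I ℤ.+ (+ 1 ℤ.+ K)) ℤ.+ (+ 1 ℤ.+ I) ℤ.- + 1 ≡ R ℤ.+ K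
  simplify = ℤSolver.solve-∀

column-offset : ∀ r i k j → j ℤ.- (+ suc i ℤ.- + length (P (i + suc k) r)) ≡ j ℤ.+ + k
column-offset r i k j = begin
    j ℤ.- (+ suc i ℤ.- + length (P (i + suc k) r))
  ≡⟨ cong (λ m → j ℤ.- (+ suc i ℤ.- + m)) (length-P (i + suc k) r) ⟩
    j ℤ.- (+ suc i ℤ.- + (i + suc k))
  ≡⟨ cong (λ t → j ℤ.- t) (first-column i k) ⟩
    j ℤ.- ℤ.- (+ k)
  ≡⟨ cong (λ t → j ℤ.+ t) (ℤP.neg-involutive (+ k)) ⟩
    j ℤ.+ + k
  ∎ where open ≡-Reasoning

entry-P : ∀ r i k j → ℤ.- (+ k) ℤ.≤ j → j ℤ.≤ + (r + k) →
  entry (P (i + suc k) r) (suc i) j ≡ just (Pval r j)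
entry-P r i k (+ n) _ (ℤ.+≤+ n≤r+k) = begin
    entry (P (i + suc k) r) (suc i) (+ n)
  ≡⟨ entry-via-nth (P (i + suc k) r) i (+ n) (n + k) (column-offset r i k (+ n)) (nth-P i k r) ⟩
    nth (P-row k r) (n + k)
  ≡⟨ cong (nth (P-row k r)) (trans (+-comm n k) (cong (_+ n) (sym (length-descending r k)))) ⟩
    nth (descending r k ++ ascending 0 (suc (r + k))) (length (descending r k) + n)
  ≡⟨ nth-++ʳ (descending r k) _ n ⟩
    nth (ascending 0 (suc (r + k))) n
  ≡⟨ nth-ascending 0 (suc (r + k)) (s≤s n≤r+k) ⟩
    just n
  ∎ where open ≡-Reasoning
entry-P r i (suc k) -[1+ n ] (ℤ.-≤- n≤k) _ = begin
    entry (P (i + suc (suc k)) r) (suc i) -[1+ n ]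
  ≡⟨ entry-via-nth (P (i + suc (suc k)) r) i -[1+ n ] (k ∸ n) offset≡ (nth-P i (suc k) r) ⟩
    nth (descending r (suc k) ++ ascending 0 (suc (r + suc k))) (k ∸ n)
  ≡⟨ nth-++ˡ (descending r (suc k)) _
       (subst (k ∸ n <_) (sym (length-descending r (suc k))) (s≤s (m∸n≤m k n))) ⟩
    nth (descending r (suc k)) (k ∸ n)
  ≡⟨ cong (λ m → nth (descending r m) (k ∸ n)) (sym k∸n+1+n≡1+k) ⟩
    nth (descending r (k ∸ n + suc n)) (k ∸ n)
  ≡⟨ nth-descending r (k ∸ n) n ⟩
    just (r + suc n)
  ∎
  where
  open ≡-Reasoning
  offset≡ : -[1+ n ] ℤ.- (+ suc i ℤ.- + length (P (i + suc (suc k)) r)) ≡ + (k ∸ n)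
  offset≡ = trans (column-offset r i (suc k) -[1+ n ])
                  (trans (ℤP.[1+m]⊖[1+n]≡m⊖n k n) (ℤP.⊖-≥ n≤k))
  k∸n+1+n≡1+k : k ∸ n + suc n ≡ suc k
  k∸n+1+n≡1+k = trans (+-suc (k ∸ n) n) (cong suc (m∸n+n≡m n≤k))

entries-P : ∀ d r i j → InD (Z d r) i j → entry (P d r) i j ≡ just (Pval r j)
entries-P d r (suc i) j (_ , part≡ , first≤j , j≤last) with nth-Z d r i part≡
... | k , refl , refl = entry-P r i k j (subst (ℤ._≤ j) first≡ first≤j) (subst (j ℤ.≤_) last≡ j≤last)
  where
  first≡ : + suc i ℤ.- + length (Z (i + suc k) r) ≡ ℤ.- (+ k)
  first≡ = trans (cong (λ m → + suc i ℤ.- + m) (length-Z (i + suc k) r)) (first-column i k)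
  last≡ : + (r + 2 * k + 1) ℤ.- + length (Z (i + suc k) r) ℤ.+ + suc i ℤ.- + 1 ≡ + (r + k)
  last≡ = trans (cong (λ m → + (r + 2 * k + 1) ℤ.- + m ℤ.+ + suc i ℤ.- + 1) (length-Z (i + suc k) r))
                (last-column r i k)

proposition4p9 : (d r : ℕ) → 0 < d →
    Σ Tableau λ P → IsSDT (d + r) (wdr d r) P × shape P ≡ Z d r ×
    ((i : ℕ) (j : ℤ) → InD (Z d r) i j → entry P i j ≡ just (Pval r j))
proposition4p9 d r _ = P d r , isSDT-P d r , shape-P d r , entries-P d r
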